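{- The hypersequent calculus $\mathbf{HLJ}'+(\mathrm{ls})$ proves the generalised De Morgan's law $\mathsf{GDM}$: for all propositional formulas $\gamma_1,\gamma_2,\delta$ it derives the hypersequent $\Rightarrow((\gamma_1\land\gamma_2)\to\delta)\to(\gamma_1\to\delta)\lor(\gamma_2\to\delta)$.
   Context: Formulas are built from atoms and $\bot$ with $\land,\lor,\to$. A sequent $\Gamma\Rightarrow\Delta$ consists of finite sequences of formulas; a hypersequent is a finite sequence of sequents $\Gamma_1\Rightarrow\Delta_1\mid\cdots\mid\Gamma_n\Rightarrow\Delta_n$; $G,H$ denote possibly empty hypersequents, $S,T$ sequents. $\mathbf{HLK}$ has: axioms $\varphi\Rightarrow\varphi$, $\bot\Rightarrow\varphi$; external weakening (from $G$ infer $S\mid G$), contraction (from $S\mid S\mid G$ infer $S\mid G$), exchange (from $G\mid S\mid T\mid H$ infer $G\mid T\mid S\mid H$); internal weakening, contraction and exchange on either side of a component, with arbitrary side hypersequent $G$; cut: from $\Gamma_0\Rightarrow\Delta_0,\delta\mid G$ and $\delta,\Gamma_1\Rightarrow\Delta_1\mid G$ infer $\Gamma_0,\Gamma_1\Rightarrow\Delta_0,\Delta_1\mid G$; logical rules with side hypersequent $G$: from $\varphi_i,\Gamma\Rightarrow\Delta\mid G$ infer $\varphi_1\land\varphi_2,\Gamma\Rightarrow\Delta\mid G$; from $\Gamma\Rightarrow\Delta,\varphi_1\mid G$ and $\Gamma\Rightarrow\Delta,\varphi_2\mid G$ infer $\Gamma\Rightarrow\Delta,\varphi_1\land\varphi_2\mid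 G$; from $\varphi_1,\Gamma\Rightarrow\Delta\mid G$ and $\varphi_2,\Gamma\Rightarrow\Delta\mid G$ infer $\varphi_1\lor\varphi_2,\Gamma\Rightarrow\Delta\mid G$; from $\Gamma\Rightarrow\Delta,\varphi_i\mid G$ infer $\Gamma\Rightarrow\Delta,\varphi_1\lor\varphi_2\mid G$; from $\Gamma\Rightarrow\Delta,\varphi\mid G$ and $\psi,\Gamma\Rightarrow\Delta\mid G$ infer $\varphi\to\psi,\Gamma\Rightarrow\Delta\mid G$; from $\varphi,\Gamma\Rightarrow\Delta,\psi\mid G$ infer $\Gamma\Rightarrow\Delta,\varphi\to\psi\mid G$. $\mathbf{HLJ}'$ is $\mathbf{HLK}$ with the last rule replaced by: from $\varphi,\Gamma\Rightarrow\psi\mid G$ infer $\Gamma\Rightarrow\varphi\to\psi\mid G$. $(\mathrm{ls})$ (left split): from $\Gamma_1,\Gamma_2\Rightarrow\Delta\mid G$ infer $\Gamma_1\Rightarrow\Delta\mid\Gamma_2\Rightarrow\Delta\mid G$. -}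

module Defs where

open import Data.Nat using (ℕ)
open import Data.List using (List; []; _∷_; _++_; [_])
open import Data.Product using (_×_; _,_)

data Fm : Set where
  atom : ℕ → Fm
  ⊥'   : Fm
  _∧'_ : Fm → Fm → Fm
  _∨'_ : Fm → Fm → Fm
  _⇒'_ : Fm → Fm → Fm

infixr 9 _∧'_
infixr 8 _∨'_
infixr 7 _⇒'_

record Seq : Set where
  constructor _⊢_
  field
    ante : List Fm
    succ : List Fm

infix 3 _⊢_

HSeq : Set
HSeq = List Seq

-- Derivability in HLJ' + (ls).
-- In every rule the active component is written first, followed by the side
-- hypersequent G; external exchange permits arbitrary positions.
data HLJ'ls : HSeq → Set where
  ax    : ∀ φ → HLJ'ls ((φ ∷ [] ⊢ φ ∷ []) ∷ [])
  ax⊥   : ∀ φ → HLJ'ls ((⊥' ∷ [] ⊢ φ ∷ []) ∷ [])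
  ew    : ∀ {S G} → HLJ'ls G → HLJ'ls (S ∷ G)
  ec    : ∀ {S G} → HLJ'ls (S ∷ S ∷ G) → HLJ'ls (S ∷ G)
  ee    : ∀ {G S T H} → HLJ'ls (G ++ S ∷ T ∷ H) → HLJ'ls (G ++ T ∷ S ∷ H)
  wl    : ∀ {φ Γ Δ G} → HLJ'ls ((Γ ⊢ Δ) ∷ G) → HLJ'ls ((φ ∷ Γ ⊢ Δ) ∷ G)
  wr    : ∀ {φ Γ Δ G} → HLJ'ls ((Γ ⊢ Δ) ∷ G) → HLJ'ls ((Γ ⊢ Δ ++ [ φ ]) ∷ G)
  cl    : ∀ {φ Γ Δ G} → HLJ'ls ((φ ∷ φ ∷ Γ ⊢ Δ) ∷ G) → HLJ'ls ((φ ∷ Γ ⊢ Δ) ∷ G)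
  cr    : ∀ {φ Γ Δ G} → HLJ'ls ((Γ ⊢ Δ ++ φ ∷ φ ∷ []) ∷ G) → HLJ'ls ((Γ ⊢ Δ ++ [ φ ]) ∷ G)
  el    : ∀ {Γ φ ψ Γ' Δ G} → HLJ'ls ((Γ ++ φ ∷ ψ ∷ Γ' ⊢ Δ) ∷ G)
                           → HLJ'ls ((Γ ++ ψ ∷ φ ∷ Γ' ⊢ Δ) ∷ G)
  er    : ∀ {Γ Δ φ ψ Δ' G} → HLJ'ls ((Γ ⊢ Δ ++ φ ∷ ψ ∷ Δ') ∷ G)
                           → HLJ'ls ((Γ ⊢ Δ ++ ψ ∷ φ ∷ Δ') ∷ G)
  cut   : ∀ {Γ₀ Δ₀ Γ₁ Δ₁ δ G}
        → HLJ'ls ((Γ₀ ⊢ Δ₀ ++ [ δ ]) ∷ G)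
        → HLJ'ls ((δ ∷ Γ₁ ⊢ Δ₁) ∷ G)
        → HLJ'ls ((Γ₀ ++ Γ₁ ⊢ Δ₀ ++ Δ₁) ∷ G)
  ∧l₁   : ∀ {φ₁ φ₂ Γ Δ G} → HLJ'ls ((φ₁ ∷ Γ ⊢ Δ) ∷ G) → HLJ'ls ((φ₁ ∧' φ₂ ∷ Γ ⊢ Δ) ∷ G)
  ∧l₂   : ∀ {φ₁ φ₂ Γ Δ G} → HLJ'ls ((φ₂ ∷ Γ ⊢ Δ) ∷ G) → HLJ'ls ((φ₁ ∧' φ₂ ∷ Γ ⊢ Δ) ∷ G)
  ∧r    : ∀ {φ₁ φ₂ Γ Δ G} → HLJ'ls ((Γ ⊢ Δ ++ [ φ₁ ]) ∷ G) → HLJ'ls ((Γ ⊢ Δ ++ [ φ₂ ]) ∷ G)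
        → HLJ'ls ((Γ ⊢ Δ ++ [ φ₁ ∧' φ₂ ]) ∷ G)
  ∨l    : ∀ {φ₁ φ₂ Γ Δ G} → HLJ'ls ((φ₁ ∷ Γ ⊢ Δ) ∷ G) → HLJ'ls ((φ₂ ∷ Γ ⊢ Δ) ∷ G)
        → HLJ'ls ((φ₁ ∨' φ₂ ∷ Γ ⊢ Δ) ∷ G)
  ∨r₁   : ∀ {φ₁ φ₂ Γ Δ G} → HLJ'ls ((Γ ⊢ Δ ++ [ φ₁ ]) ∷ G) → HLJ'ls ((Γ ⊢ Δ ++ [ φ₁ ∨' φ₂ ]) ∷ G)
  ∨r₂   : ∀ {φ₁ φ₂ Γ Δ G} → HLJ'ls ((Γ ⊢ Δ ++ [ φ₂ ]) ∷ G) → HLJ'ls ((Γ ⊢ Δ ++ [ φ₁ ∨' φ₂ ]) ∷ G)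
  →l    : ∀ {φ ψ Γ Δ G} → HLJ'ls ((Γ ⊢ Δ ++ [ φ ]) ∷ G) → HLJ'ls ((ψ ∷ Γ ⊢ Δ) ∷ G)
        → HLJ'ls ((φ ⇒' ψ ∷ Γ ⊢ Δ) ∷ G)
  →r'   : ∀ {φ ψ Γ G} → HLJ'ls ((φ ∷ Γ ⊢ [ ψ ]) ∷ G) → HLJ'ls ((Γ ⊢ [ φ ⇒' ψ ]) ∷ G)
  ls    : ∀ {Γ₁ Γ₂ Δ G} → HLJ'ls ((Γ₁ ++ Γ₂ ⊢ Δ) ∷ G)
        → HLJ'ls ((Γ₁ ⊢ Δ) ∷ (Γ₂ ⊢ Δ) ∷ G)

GDM : Fm → Fm → Fm → Fm
GDM γ₁ γ₂ δ = ((γ₁ ∧' γ₂) ⇒' δ) ⇒' ((γ₁ ⇒' δ) ∨' (γ₂ ⇒' δ))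

{-# OPTIONS --safe #-}
module Submission where

-- From A = γ₁ ∧ γ₂ → δ we get A, γ₂, γ₁ ⇒ δ. Left split moves γ₁ into its own
-- component, and weakening puts A back there, giving γ₁, A ⇒ δ | γ₂, A ⇒ δ.
-- Each component now yields A ⇒ (γ₁ → δ) ∨ (γ₂ → δ), one through each disjunct,
-- and external contraction merges the two identical components.

open import Defs
open import Data.List using (List; []; _∷_; [_])

private
  variable
    φ ψ χ : Fm
    Γ Δ : List Fm
    S T : Seq
    G : HSeq

swap : HLJ'ls (S ∷ T ∷ G) → HLJ'ls (T ∷ S ∷ G)
swap = ee {G = []}

exchangeˡ : HLJ'ls ((φ ∷ ψ ∷ Γ ⊢ Δ) ∷ G) → HLJ'ls ((ψ ∷ φ ∷ Γ ⊢ Δ) ∷ G)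
exchangeˡ = el {Γ = []}

→r-∨r₁ : HLJ'ls ((φ ∷ Γ ⊢ [ ψ ]) ∷ G) → HLJ'ls ((Γ ⊢ [ (φ ⇒' ψ) ∨' χ ]) ∷ G)
→r-∨r₁ p = ∨r₁ {Δ = []} (→r' p)

→r-∨r₂ : HLJ'ls ((φ ∷ Γ ⊢ [ ψ ]) ∷ G) → HLJ'ls ((Γ ⊢ [ χ ∨' (φ ⇒' ψ) ]) ∷ G)
→r-∨r₂ p = ∨r₂ {Δ = []} (→r' p)

∧-modusPonens : ∀ γ₁ γ₂ δ → HLJ'ls ((γ₁ ∧' γ₂ ⇒' δ ∷ γ₂ ∷ γ₁ ∷ [] ⊢ [ δ ]) ∷ [])
∧-modusPonens γ₁ γ₂ δ = →l {Δ = [ δ ]} (∧r {Δ = [ δ ]} ⊢γ₁ ⊢γ₂) δ⊢δ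
  where
  ⊢γ₁ : HLJ'ls ((γ₂ ∷ γ₁ ∷ [] ⊢ δ ∷ γ₁ ∷ []) ∷ [])
  ⊢γ₁ = er {Δ = []} (wr (wl (ax γ₁)))

  ⊢γ₂ : HLJ'ls ((γ₂ ∷ γ₁ ∷ [] ⊢ δ ∷ γ₂ ∷ []) ∷ [])
  ⊢γ₂ = er {Δ = []} (wr (exchangeˡ (wl (ax γ₂))))

  δ⊢δ : HLJ'ls ((δ ∷ γ₂ ∷ γ₁ ∷ [] ⊢ [ δ ]) ∷ [])
  δ⊢δ = exchangeˡ (wl (exchangeˡ (wl (ax δ))))

∧⇒-split : ∀ γ₁ γ₂ δ →
  HLJ'ls ((γ₁ ∷ γ₁ ∧' γ₂ ⇒' δ ∷ [] ⊢ [ δ ]) ∷ (γ₂ ∷ γ₁ ∧' γ₂ ⇒' δ ∷ [] ⊢ [ δ ]) ∷ [])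
∧⇒-split γ₁ γ₂ δ =
  exchangeˡ (wl (swap (ls {Γ₁ = γ₂ ∷ γ₁ ∧' γ₂ ⇒' δ ∷ []} (exchangeˡ (∧-modusPonens γ₁ γ₂ δ)))))

mainTheorem3 : ∀ (γ₁ γ₂ δ : Fm) → HLJ'ls ((([] ⊢ (GDM γ₁ γ₂ δ ∷ [])) ∷ []))
mainTheorem3 γ₁ γ₂ δ = →r' (ec (→r-∨r₂ (swap (→r-∨r₁ (∧⇒-split γ₁ γ₂ δ)))))
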